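{- Let $\lambda$ be a partition of $n$ and let $h$ be the hook length of a box of the Young diagram of $\lambda$ which is not in position $(1,1)$. If $2h-n\geq 0$, then $(2h-n)!$ divides the hook product $\Pi(\lambda)$.
   Context: A partition $\lambda=(\lambda_1\geq\lambda_2\geq\dots\geq\lambda_s)$ of $n$ has Young diagram consisting of boxes $(i,j)$ (row $i$, column $j$) with $i,j\geq1$ and $j\leq\lambda_i$. The arm of box $(i,j)$ is the set of boxes $(i,k)$ with $k>j$; its leg is the set of boxes $(k,j)$ with $k>i$. The hook length of $(i,j)$ is the number of boxes in its arm plus the number in its leg plus one. The hook product $\Pi(\lambda)$ is the product of the hook lengths of all boxes of the diagram. -}

module Defs where

open import Data.Nat using (ℕ; zero; suc; _+_; _*_; _∸_; _≤_; _<_; _≥_)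
open import Data.Nat.ListAction using (sum; product)
open import Data.List using (List; []; _∷_; map; concatMap; length; filter; upTo; drop)
open import Data.List.Relation.Unary.All using (All)
open import Data.List.Relation.Unary.Linked using (Linked)
open import Data.Nat.Properties using (_≤?_)
open import Data.Product using (_×_)
open import Relation.Binary.PropositionalEquality using (_≡_)

IsPartition : ℕ → List ℕ → Set
IsPartition n p = Linked _≥_ p × All (λ x → 0 < x) p × sum p ≡ n

-- pᵢ with 1-indexed rows; rows beyond the length have size 0.
row : List ℕ → ℕ → ℕ
row [] i = 0
row (x ∷ xs) zero = 0
row (x ∷ xs) (suc zero) = x
row (x ∷ xs) (suc (suc i)) = row xs (suc i)

InDiagram : List ℕ → ℕ → ℕ → Set
InDiagram p i j = 1 ≤ i × 1 ≤ j × j ≤ row p i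

arm : List ℕ → ℕ → ℕ → ℕ
arm p i j = row p i ∸ j

-- leg of (i,j): number of boxes (k,j) with k > i, i.e. #{k > i : pₖ ≥ j}.
leg : List ℕ → ℕ → ℕ → ℕ
leg p i j = length (filter (λ x → j ≤? x) (drop i p))

hook : List ℕ → ℕ → ℕ → ℕ
hook p i j = arm p i j + leg p i j + 1

hooksFrom : ℕ → List ℕ → List ℕ → List ℕ
hooksFrom i p [] = []
hooksFrom i p (x ∷ xs) =
  map (λ j → hook p i (suc j)) (upTo x) Data.List.++ hooksFrom (suc i) p xs

hookProduct : List ℕ → ℕ
hookProduct p = product (hooksFrom 1 p p)

module Submission where

-- Let the box be (i, j), let x = λᵢ be the length of its row, rest the list of
-- rows below row i, ℓ the leg and P the number of boxes above row i, so that
-- n = P + x + |rest| and h = (x - j) + ℓ + 1.  We exhibit a number B with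
-- B! ∣ Π(λ) and 2h ≤ n + B; then 2h - n ≤ B gives (2h - n)! ∣ B! ∣ Π(λ).
--
-- * j ≥ 2.  The boxes of row i to the right of column y = λᵢ₊₁ have empty legs,
--   so their hooks are x - y, …, 2, 1 and B = x - y works.  The bound holds
--   because every row counted by the leg has at least j ≥ 2 boxes.
-- * j = 1, i ≥ 2.  The c rows of length 1 end the first column, where their
--   boxes have hooks c, …, 2, 1, and B = c works.  The bound holds because
--   x ≤ λ₁ ≤ P and every row y below satisfies 2 ≤ y + [y = 1].

open import Defs
open import Data.Nat using (ℕ; _+_; _*_; _∸_; _≤_)
open import Data.Nat.Divisibility using (_∣_)
open import Data.Nat.Base using (_!)
open import Data.List using (List)
open import Data.Product using (_×_)
open import Relation.Binary.PropositionalEquality using (_≡_)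
open import Relation.Nullary using (¬_)

open import Data.Nat.Base using (zero; suc; _<_; _≥_; z≤n; s≤s)
open import Data.Nat.Properties
open import Data.Nat.Divisibility using (∣-refl; ∣-trans; *-pres-∣; ∣n⇒∣m*n; ∣m⇒∣m*n; m≤n⇒m!∣n!)
open import Data.Nat.ListAction using (sum; product)
open import Data.Nat.ListAction.Properties using (sum-++; product-++; ∈⇒∣product)
open import Data.Nat.Tactic.RingSolver using (solve-∀)
open import Data.List using ([]; _∷_; _++_; map; filter; length; take; drop; upTo; applyUpTo)
open import Data.List.Properties using (map-upTo; take++drop≡id; filter-accept; filter-reject; filter-none)
open import Data.List.Membership.Propositional.Properties using (∈-map⁺; ∈-upTo⁺)
open import Data.List.Relation.Unary.All as All using (All; []; _∷_)
open import Data.List.Relation.Unary.Linked as Linked using (Linked)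
open import Data.List.Relation.Unary.Linked.Properties using (Linked⇒All)
open import Relation.Binary.PropositionalEquality using (refl; sym; trans; cong; cong₂; subst; subst₂; _≢_; module ≡-Reasoning)
open import Relation.Nullary using (yes; no)
open import Data.Empty using (⊥-elim)
open import Data.Product using (_,_)

-- Number of parts that are at least j.  By definition, the leg of (i, j) is
-- atLeast j of the list of rows strictly below row i.
atLeast : ℕ → List ℕ → ℕ
atLeast j xs = length (filter (j ≤?_) xs)

equalTo : ℕ → List ℕ → ℕ
equalTo j xs = length (filter (_≟ j) xs)

atLeast-accept : ∀ {j y} ys → j ≤ y → atLeast j (y ∷ ys) ≡ suc (atLeast j ys)
atLeast-accept {j} _ j≤y = cong length (filter-accept (j ≤?_) j≤y)

atLeast-reject : ∀ {j y} ys → ¬ j ≤ y → atLeast j (y ∷ ys) ≡ atLeast j ys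
atLeast-reject {j} _ j≰y = cong length (filter-reject (j ≤?_) j≰y)

equalTo-accept : ∀ {j} ys → equalTo j (j ∷ ys) ≡ suc (equalTo j ys)
equalTo-accept {j} _ = cong length (filter-accept (_≟ j) refl)

equalTo-reject : ∀ {j y} ys → y ≢ j → equalTo j (y ∷ ys) ≡ equalTo j ys
equalTo-reject {j} _ y≢j = cong length (filter-reject (_≟ j) y≢j)

atLeast-none : ∀ t xs → All (_< t) xs → atLeast t xs ≡ 0
atLeast-none t xs all<t = cong length (filter-none (t ≤?_) (All.map <⇒≱ all<t))

atLeast≡equalTo : ∀ j xs → All (_≤ j) xs → atLeast j xs ≡ equalTo j xs
atLeast≡equalTo j [] [] = refl
atLeast≡equalTo j (y ∷ ys) (y≤j ∷ ys≤j) with y ≟ j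
... | yes refl = trans (atLeast-accept ys ≤-refl)
                       (trans (cong suc (atLeast≡equalTo j ys ys≤j)) (sym (equalTo-accept ys)))
... | no y≢j = trans (atLeast-reject ys (λ j≤y → y≢j (≤-antisym y≤j j≤y)))
                     (trans (atLeast≡equalTo j ys ys≤j) (sym (equalTo-reject ys y≢j)))

equalTo-∷ : ∀ j y ys → equalTo j ys ≤ equalTo j (y ∷ ys)
equalTo-∷ j y ys with y ≟ j
... | yes refl = ≤-trans (n≤1+n _) (≤-reflexive (sym (equalTo-accept ys)))
... | no y≢j = ≤-reflexive (sym (equalTo-reject ys y≢j))

equalTo-drop : ∀ j k xs → equalTo j (drop k xs) ≤ equalTo j xs
equalTo-drop j zero xs = ≤-refl
equalTo-drop j (suc k) [] = ≤-refl
equalTo-drop j (suc k) (y ∷ ys) = ≤-trans (equalTo-drop j k ys) (equalTo-∷ j y ys)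

-- Each part counted by atLeast j has at least j boxes.
*-atLeast-≤-sum : ∀ j xs → j * atLeast j xs ≤ sum xs
*-atLeast-≤-sum j [] = ≤-reflexive (*-zeroʳ j)
*-atLeast-≤-sum j (y ∷ ys) with j ≤? y
... | yes j≤y = begin
  j * atLeast j (y ∷ ys)  ≡⟨ cong (j *_) (atLeast-accept ys j≤y) ⟩
  j * suc (atLeast j ys)  ≡⟨ *-suc j _ ⟩
  j + j * atLeast j ys    ≤⟨ +-mono-≤ j≤y (*-atLeast-≤-sum j ys) ⟩
  y + sum ys              ∎
  where open ≤-Reasoning
... | no j≰y = begin
  j * atLeast j (y ∷ ys)  ≡⟨ cong (j *_) (atLeast-reject ys j≰y) ⟩
  j * atLeast j ys        ≤⟨ *-atLeast-≤-sum j ys ⟩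
  sum ys                  ≤⟨ m≤n+m _ y ⟩
  y + sum ys              ∎
  where open ≤-Reasoning

twice-atLeast-≤-sum : ∀ j xs → 2 ≤ j → 2 * atLeast j xs ≤ sum xs
twice-atLeast-≤-sum j xs 2≤j = ≤-trans (*-monoˡ-≤ (atLeast j xs) 2≤j) (*-atLeast-≤-sum j xs)

-- Every nonempty part y satisfies 2 ≤ y + [y = 1].
twice-nonempty-≤ : ∀ xs → 2 * atLeast 1 xs ≤ sum xs + equalTo 1 xs
twice-nonempty-≤ [] = z≤n
twice-nonempty-≤ (zero ∷ ys) = twice-nonempty-≤ ys
twice-nonempty-≤ (suc zero ∷ ys) = begin
  2 * suc (atLeast 1 ys)              ≡⟨ *-suc 2 _ ⟩
  2 + 2 * atLeast 1 ys                ≤⟨ +-monoʳ-≤ 2 (twice-nonempty-≤ ys) ⟩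
  2 + (sum ys + equalTo 1 ys)         ≡⟨ cong suc (sym (+-suc (sum ys) _)) ⟩
  1 + sum ys + suc (equalTo 1 ys)     ∎
  where open ≤-Reasoning
twice-nonempty-≤ (suc (suc y) ∷ ys) = begin
  2 * suc (atLeast 1 ys)              ≡⟨ *-suc 2 _ ⟩
  2 + 2 * atLeast 1 ys                ≤⟨ +-monoʳ-≤ 2 (twice-nonempty-≤ ys) ⟩
  2 + (sum ys + equalTo 1 ys)         ≤⟨ +-monoʳ-≤ 2 (+-monoˡ-≤ _ (m≤n+m (sum ys) y)) ⟩
  2 + (y + sum ys + equalTo 1 ys)     ∎
  where open ≤-Reasoning

≤-head : ∀ {y ys} → Linked _≥_ (y ∷ ys) → All (_≤ y) ys
≤-head decr = All.tail (Linked⇒All (λ a≥b b≥c → ≤-trans b≥c a≥b) ≤-refl decr)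

drop-Linked : ∀ k xs → Linked _≥_ xs → Linked _≥_ (drop k xs)
drop-Linked zero xs decr = decr
drop-Linked (suc k) [] decr = decr
drop-Linked (suc k) (y ∷ ys) decr = drop-Linked k ys (Linked.tail decr)

row-≤ : ∀ k xs {c} → All (_≤ c) xs → row xs k ≤ c
row-≤ k [] _ = z≤n
row-≤ zero (y ∷ ys) _ = z≤n
row-≤ (suc zero) (y ∷ ys) (y≤c ∷ _) = y≤c
row-≤ (suc (suc k)) (y ∷ ys) (_ ∷ ys≤c) = row-≤ (suc k) ys ys≤c

≤-row-1 : ∀ xs → Linked _≥_ xs → All (_≤ row xs 1) xs
≤-row-1 [] _ = []
≤-row-1 (y ∷ ys) decr = ≤-refl ∷ ≤-head decr

row-≤-above : ∀ i' p → Linked _≥_ p → 1 ≤ i' → row p (suc i') ≤ sum (take i' p)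
row-≤-above (suc i'') [] _ _ = z≤n
row-≤-above (suc i'') (y ∷ ys) decr _ =
  ≤-trans (row-≤ (suc i'') ys (≤-head decr)) (m≤m+n y (sum (take i'' ys)))

drop-row : ∀ i' (p : List ℕ) → 1 ≤ row p (suc i') → drop i' p ≡ row p (suc i') ∷ drop (suc i') p
drop-row zero (y ∷ ys) _ = refl
drop-row (suc i') (y ∷ ys) nonempty = drop-row i' ys nonempty

row-of-drop : ∀ i' (p : List ℕ) {y ys} → drop i' p ≡ y ∷ ys → row p (suc i') ≡ y
row-of-drop zero (x ∷ xs) refl = refl
row-of-drop (suc i') (x ∷ xs) eq = row-of-drop i' xs eq

drop-of-drop : ∀ i' (p : List ℕ) {y ys} → drop i' p ≡ y ∷ ys → drop (suc i') p ≡ ys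
drop-of-drop zero (x ∷ xs) refl = refl
drop-of-drop (suc i') (x ∷ xs) eq = drop-of-drop i' xs eq

sum-around-row : ∀ i' p → 1 ≤ row p (suc i') →
  sum p ≡ sum (take i' p) + (row p (suc i') + sum (drop (suc i') p))
sum-around-row i' p nonempty = begin
  sum p                                ≡⟨ cong sum (sym (take++drop≡id i' p)) ⟩
  sum (take i' p ++ drop i' p)         ≡⟨ sum-++ (take i' p) (drop i' p) ⟩
  sum (take i' p) + sum (drop i' p)    ≡⟨ cong (λ d → sum (take i' p) + sum d) (drop-row i' p nonempty) ⟩
  sum (take i' p) + (row p (suc i') + sum (drop (suc i') p)) ∎
  where open ≡-Reasoning

!-∣-applyUpTo : ∀ x c (f : ℕ → ℕ) → (∀ t → c ≤ t → t < x → f t ≡ x ∸ t) →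
  (x ∸ c) ! ∣ product (applyUpTo f x)
!-∣-applyUpTo zero c f _ rewrite 0∸n≡0 c = ∣-refl
!-∣-applyUpTo (suc x) zero f values rewrite values 0 z≤n (s≤s z≤n) =
  *-pres-∣ (∣-refl {suc x})
    (!-∣-applyUpTo x zero (λ t → f (suc t)) (λ t _ t<x → values (suc t) z≤n (s≤s t<x)))
!-∣-applyUpTo (suc x) (suc c) f values =
  ∣n⇒∣m*n (f 0)
    (!-∣-applyUpTo x c (λ t → f (suc t)) (λ t c≤t t<x → values (suc t) (s≤s c≤t) (s≤s t<x)))

rowHooks : List ℕ → ℕ → ℕ → List ℕ
rowHooks p i x = map (λ j → hook p i (suc j)) (upTo x)

hooksFrom-∷ : ∀ i p x xs →
  product (hooksFrom i p (x ∷ xs)) ≡ product (rowHooks p i x) * product (hooksFrom (suc i) p xs)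
hooksFrom-∷ i p x xs = product-++ (rowHooks p i x) (hooksFrom (suc i) p xs)

rowHooks-∣ : ∀ p xs i k → product (rowHooks p (k + i) (row xs (suc k))) ∣ product (hooksFrom i p xs)
rowHooks-∣ p [] i k = ∣-refl
rowHooks-∣ p (x ∷ xs) i zero =
  subst (product (rowHooks p i x) ∣_) (sym (hooksFrom-∷ i p x xs)) (∣m⇒∣m*n _ ∣-refl)
rowHooks-∣ p (x ∷ xs) i (suc k) =
  subst (product (rowHooks p (suc k + i) (row xs (suc k))) ∣_) (sym (hooksFrom-∷ i p x xs))
    (∣n⇒∣m*n (product (rowHooks p i x)) (subst (λ r → product (rowHooks p r (row xs (suc k))) ∣ product (hooksFrom (suc i) p xs))
                      (+-suc k i) (rowHooks-∣ p xs (suc i) k)))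

rowHooks-∣-hookProduct : ∀ p i' → product (rowHooks p (suc i') (row p (suc i'))) ∣ hookProduct p
rowHooks-∣-hookProduct p i' =
  subst (λ r → product (rowHooks p r (row p (suc i'))) ∣ hookProduct p) (+-comm i' 1) (rowHooks-∣ p p 1 i')

-- Case j ≥ 2: in row i the boxes to the right of column y = λᵢ₊₁ have empty
-- legs, so their hooks are x - y, …, 2, 1.
rowEnd-!-∣ : ∀ p i' → Linked _≥_ p →
  (row p (suc i') ∸ row (drop (suc i') p) 1) ! ∣ hookProduct p
rowEnd-!-∣ p i' decr =
  ∣-trans (subst ((x ∸ y) ! ∣_) (cong product (sym (map-upTo f x))) (!-∣-applyUpTo x y f emptyLegs))
          (rowHooks-∣-hookProduct p i')
  where
  x = row p (suc i')
  rest = drop (suc i') p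
  y = row rest 1
  f : ℕ → ℕ
  f t = hook p (suc i') (suc t)
  emptyLegs : ∀ t → y ≤ t → t < x → f t ≡ x ∸ t
  emptyLegs t y≤t t<x = begin
    x ∸ suc t + atLeast (suc t) rest + 1  ≡⟨ cong (λ ℓ → x ∸ suc t + ℓ + 1) (atLeast-none (suc t) rest below) ⟩
    x ∸ suc t + 0 + 1                     ≡⟨ cong (_+ 1) (+-identityʳ (x ∸ suc t)) ⟩
    x ∸ suc t + 1                         ≡⟨ +-comm (x ∸ suc t) 1 ⟩
    1 + (x ∸ suc t)                       ≡⟨ +-∸-assoc 1 t<x ⟨
    x ∸ t                                 ∎
    where
    open ≡-Reasoning
    below : All (_< suc t) rest
    below = All.map (λ z≤y → s≤s (≤-trans z≤y y≤t)) (≤-row-1 rest (drop-Linked (suc i') p decr))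

-- Case j = 1 (for any column j ≥ 1): the rows of length exactly j end column j,
-- and the box of such a row in column j has hook 1 + (number of such rows
-- below it); so these hooks are c, …, 2, 1 for c the number of such rows.
columnEnd-!-∣ : ∀ p j' i' xs → drop i' p ≡ xs → Linked _≥_ xs →
  equalTo (suc j') xs ! ∣ product (hooksFrom (suc i') p xs)
columnEnd-!-∣ p j' i' [] _ _ = ∣-refl
columnEnd-!-∣ p j' i' (x ∷ xs) eq decr with x ≟ suc j'
... | no x≢j =
  subst₂ _∣_ (cong _! (sym (equalTo-reject xs x≢j))) (sym (hooksFrom-∷ (suc i') p x xs))
    (∣n⇒∣m*n (product (rowHooks p (suc i') x)) belowRows)
  where belowRows = columnEnd-!-∣ p j' (suc i') xs (drop-of-drop i' p eq) (Linked.tail decr)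
... | yes refl =
  subst₂ _∣_ (cong _! (sym (equalTo-accept xs))) (sym (hooksFrom-∷ (suc i') p x xs))
    (*-pres-∣ lastHook-∣ belowRows)
  where
  belowRows = columnEnd-!-∣ p j' (suc i') xs (drop-of-drop i' p eq) (Linked.tail decr)
  c = equalTo (suc j') xs
  lastHook : hook p (suc i') (suc j') ≡ suc c
  lastHook = begin
    hook p (suc i') (suc j')                       ≡⟨ cong₂ (λ r d → r ∸ suc j' + atLeast (suc j') d + 1)
                                                         (row-of-drop i' p eq) (drop-of-drop i' p eq) ⟩
    suc j' ∸ suc j' + atLeast (suc j') xs + 1      ≡⟨ cong (λ a → a + atLeast (suc j') xs + 1) (n∸n≡0 j') ⟩
    atLeast (suc j') xs + 1                        ≡⟨ cong (_+ 1) (atLeast≡equalTo (suc j') xs (≤-head decr)) ⟩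
    c + 1                                          ≡⟨ +-comm c 1 ⟩
    suc c                                          ∎
    where open ≡-Reasoning
  lastHook-∣ : suc c ∣ product (rowHooks p (suc i') (suc j'))
  lastHook-∣ = subst (_∣ product (rowHooks p (suc i') (suc j'))) lastHook
                 (∈⇒∣product (∈-map⁺ (λ t → hook p (suc i') (suc t)) (∈-upTo⁺ ≤-refl)))

2+-≤-2* : ∀ {y j} → y < j → 2 + y ≤ 2 * j
2+-≤-2* {y} {suc j} (s≤s y≤j) = begin
  2 + y      ≤⟨ +-monoʳ-≤ 2 (≤-trans y≤j (m≤n*m j 2)) ⟩
  2 + 2 * j  ≡⟨ *-suc 2 j ⟨
  2 * suc j  ∎
  where open ≤-Reasoning

-- Either the first row is counted (then y ≥ j) or it
-- is shorter than j; the other counted rows have at least 2 boxes each.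
rowsBelow-bound : ∀ j rest → 2 ≤ j → 2 * atLeast j rest + 2 + row rest 1 ≤ 2 * j + sum rest
rowsBelow-bound j [] 2≤j = ≤-trans 2≤j (≤-trans (m≤n*m j 2) (m≤m+n (2 * j) 0))
rowsBelow-bound j (y ∷ ys) 2≤j with j ≤? y
... | yes j≤y = begin
  2 * atLeast j (y ∷ ys) + 2 + y  ≡⟨ cong (λ ℓ → 2 * ℓ + 2 + y) (atLeast-accept ys j≤y) ⟩
  2 * suc (atLeast j ys) + 2 + y  ≡⟨ regroup (atLeast j ys) y ⟩
  2 * atLeast j ys + (4 + y)      ≤⟨ +-mono-≤ (twice-atLeast-≤-sum j ys 2≤j) (+-monoˡ-≤ y (*-monoʳ-≤ 2 2≤j)) ⟩
  sum ys + (2 * j + y)            ≡⟨ swap (sum ys) (2 * j) y ⟩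
  2 * j + (y + sum ys)            ∎
  where
  open ≤-Reasoning
  regroup : ∀ ℓ y → 2 * suc ℓ + 2 + y ≡ 2 * ℓ + (4 + y)
  regroup = solve-∀
  swap : ∀ s m y → s + (m + y) ≡ m + (y + s)
  swap = solve-∀
... | no j≰y = begin
  2 * atLeast j (y ∷ ys) + 2 + y  ≡⟨ cong (λ ℓ → 2 * ℓ + 2 + y) (atLeast-reject ys j≰y) ⟩
  2 * atLeast j ys + 2 + y        ≡⟨ +-assoc (2 * atLeast j ys) 2 y ⟩
  2 * atLeast j ys + (2 + y)      ≤⟨ +-mono-≤ (twice-atLeast-≤-sum j ys 2≤j) (2+-≤-2* (≰⇒> j≰y)) ⟩
  sum ys + 2 * j                  ≡⟨ +-comm (sum ys) (2 * j) ⟩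
  2 * j + sum ys                  ≤⟨ +-monoʳ-≤ (2 * j) (m≤n+m (sum ys) y) ⟩
  2 * j + (y + sum ys)            ∎
  where open ≤-Reasoning

hookBound-right : ∀ n p i' j → Linked _≥_ p → sum p ≡ n → 2 ≤ j → j ≤ row p (suc i') →
  2 * hook p (suc i') j ≤ n + (row p (suc i') ∸ row (drop (suc i') p) 1)
hookBound-right n p i' j decr sum≡n 2≤j j≤x = +-cancelʳ-≤ y _ _ (begin
  2 * (a + ℓ + 1) + y       ≡⟨ regroup a ℓ y ⟩
  2 * a + (2 * ℓ + 2 + y)   ≤⟨ +-monoʳ-≤ (2 * a) (rowsBelow-bound j rest 2≤j) ⟩
  2 * a + (2 * j + S)       ≡⟨ regroup′ a j S ⟩
  (a + j) + S + (a + j)     ≡⟨ cong (λ m → m + S + m) (m∸n+n≡m j≤x) ⟩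
  x + S + x                 ≡⟨ cong (x + S +_) (m∸n+n≡m y≤x) ⟨
  x + S + ((x ∸ y) + y)     ≡⟨ +-assoc (x + S) (x ∸ y) y ⟨
  x + S + (x ∸ y) + y       ≤⟨ +-monoˡ-≤ y (+-monoˡ-≤ (x ∸ y) (m≤n+m (x + S) P)) ⟩
  P + (x + S) + (x ∸ y) + y ≡⟨ cong (λ m → m + (x ∸ y) + y) (trans (sym (sum-around-row i' p 1≤x)) sum≡n) ⟩
  n + (x ∸ y) + y           ∎)
  where
  open ≤-Reasoning
  x = row p (suc i')
  rest = drop (suc i') p
  y = row rest 1
  S = sum rest
  P = sum (take i' p)
  ℓ = atLeast j rest
  a = x ∸ j
  1≤x : 1 ≤ x
  1≤x = ≤-trans (≤-trans (s≤s z≤n) 2≤j) j≤x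
  y≤x : y ≤ x
  y≤x = row-≤ 1 rest (≤-head (subst (Linked _≥_) (drop-row i' p 1≤x) (drop-Linked i' p decr)))
  regroup : ∀ a ℓ y → 2 * (a + ℓ + 1) + y ≡ 2 * a + (2 * ℓ + 2 + y)
  regroup = solve-∀
  regroup′ : ∀ a j S → 2 * a + (2 * j + S) ≡ (a + j) + S + (a + j)
  regroup′ = solve-∀

hookBound-firstColumn : ∀ n p i' → Linked _≥_ p → sum p ≡ n → 1 ≤ i' → 1 ≤ row p (suc i') →
  2 * hook p (suc i') 1 ≤ n + equalTo 1 p
hookBound-firstColumn n p i' decr sum≡n 1≤i' 1≤x = begin
  2 * (a + ℓ + 1)                 ≡⟨ regroup a ℓ ⟩
  (a + 1) + (a + 1) + 2 * ℓ       ≡⟨ cong (λ m → m + m + 2 * ℓ) (m∸n+n≡m 1≤x) ⟩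
  x + x + 2 * ℓ                   ≤⟨ +-mono-≤ (+-monoˡ-≤ x (row-≤-above i' p decr 1≤i')) (twice-nonempty-≤ rest) ⟩
  P + x + (S + equalTo 1 rest)    ≤⟨ +-monoʳ-≤ (P + x) (+-monoʳ-≤ S (equalTo-drop 1 (suc i') p)) ⟩
  P + x + (S + c)                 ≡⟨ regroup′ P x S c ⟩
  P + (x + S) + c                 ≡⟨ cong (_+ c) (trans (sym (sum-around-row i' p 1≤x)) sum≡n) ⟩
  n + c                           ∎
  where
  open ≤-Reasoning
  x = row p (suc i')
  rest = drop (suc i') p
  S = sum rest
  P = sum (take i' p)
  ℓ = atLeast 1 rest
  a = x ∸ 1
  c = equalTo 1 p
  regroup : ∀ a ℓ → 2 * (a + ℓ + 1) ≡ (a + 1) + (a + 1) + 2 * ℓ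
  regroup = solve-∀
  regroup′ : ∀ P x S c → P + x + (S + c) ≡ P + (x + S) + c
  regroup′ = solve-∀

!-∣-of-bound : ∀ m n B N → m ≤ n + B → B ! ∣ N → (m ∸ n) ! ∣ N
!-∣-of-bound m n B N m≤n+B B!∣N = ∣-trans (m≤n⇒m!∣n! (m≤n+o⇒m∸n≤o m n m≤n+B)) B!∣N

lemma5 : (n : ℕ) (λ′ : List ℕ) → IsPartition n λ′ →
    (i j : ℕ) → InDiagram λ′ i j → ¬ (i ≡ 1 × j ≡ 1) →
    n ≤ 2 * hook λ′ i j →
    ((2 * hook λ′ i j ∸ n) !) ∣ hookProduct λ′
lemma5 n p _ zero j (() , _) _ _
lemma5 n p _ (suc i') zero (_ , () , _) _ _
lemma5 n p (decr , _ , sum≡n) (suc i') j@(suc (suc _)) (_ , _ , j≤x) _ _ =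
  !-∣-of-bound _ n _ _ (hookBound-right n p i' j decr sum≡n (s≤s (s≤s z≤n)) j≤x) (rowEnd-!-∣ p i' decr)
lemma5 n p _ (suc zero) (suc zero) _ notCorner _ = ⊥-elim (notCorner (refl , refl))
lemma5 n p (decr , _ , sum≡n) (suc i'@(suc _)) (suc zero) (_ , _ , 1≤x) _ _ =
  !-∣-of-bound _ n _ _ (hookBound-firstColumn n p i' decr sum≡n (s≤s z≤n) 1≤x) (columnEnd-!-∣ p 0 0 p refl decr)
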